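{- For every set $A$, $A^{b_0}\leq_1 A^b$.
   Context: Let $\varphi_0,\varphi_1,\dots$ be an acceptable enumeration of the partial computable functions and $\Phi_0,\Phi_1,\dots$ an acceptable enumeration of the Turing functionals; $\langle\cdot,\cdot,\cdot\rangle$ is a computable bijective coding of triples. For a set $A$, $A\upharpoonright x=\{n\in A:n\leq x\}$. The bounded jump is $A^b=\{x: \exists i\leq x\,[\varphi_i(x)\downarrow \wedge \Phi_x^{A\upharpoonright\varphi_i(x)}(x)\downarrow]\}$, and $A^{b_0}=\{\langle e,i,j\rangle: \varphi_i(j)\downarrow\wedge\Phi_e^{A\upharpoonright\varphi_i(j)}(j)\downarrow\}$. $\leq_1$ is 1-reducibility. -}

module Defs where

open import Data.Nat using (ℕ; zero; suc; _≤_; _<_; _≤ᵇ_)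
open import Data.Fin using (Fin)
open import Data.Vec using (Vec; []; _∷_; lookup)
open import Data.Bool using (Bool; true; false; if_then_else_)
open import Data.Maybe using (Maybe; just; nothing)
open import Data.Product using (Σ; _×_; ∃)
open import Function.Definitions using (Injective; Surjective)
open import Relation.Binary.PropositionalEquality using (_≡_)

SetN : Set
SetN = ℕ → Bool

-- A (possibly partial) oracle: a query k is answered by 'just b', or the
-- computation gets stuck (diverges) on it when the answer is 'nothing'.
Oracle : Set
Oracle = ℕ → Maybe Bool

full : SetN → Oracle
full A k = just (A k)

-- the empty oracle (used for plain, oracle-free partial computable functions)
noOracle : Oracle
noOracle _ = nothing

-- A ↾ n : the finite initial segment of A up to and including n, used as an
-- oracle.  A computation with oracle A ↾ n converges only if every oracle
-- query it makes is ≤ n (use bounded by n).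
_↾_ : SetN → ℕ → Oracle
(A ↾ n) k = if k ≤ᵇ n then just (A k) else nothing

data Code : ℕ → Set where
  zer  : ∀ {n} → Code n
  succ : Code 1
  proj : ∀ {n} → Fin n → Code n
  comp : ∀ {m n} → Code m → Vec (Code n) m → Code n
  prec : ∀ {n} → Code n → Code (suc (suc n)) → Code (suc n)
  mu   : ∀ {n} → Code (suc n) → Code n
  orc  : Code 1

mutual
  data _⊢_[_]⇓_ (O : Oracle) : ∀ {n} → Code n → Vec ℕ n → ℕ → Set where
    ev-zer  : ∀ {n} {xs : Vec ℕ n} → O ⊢ zer [ xs ]⇓ 0
    ev-succ : ∀ {x} → O ⊢ succ [ x ∷ [] ]⇓ suc x
    ev-proj : ∀ {n} {i : Fin n} {xs} → O ⊢ proj i [ xs ]⇓ lookup xs i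
    ev-comp : ∀ {m n} {f : Code m} {gs : Vec (Code n) m} {xs ys y} →
              O ⊢ gs [ xs ]⇓* ys → O ⊢ f [ ys ]⇓ y → O ⊢ comp f gs [ xs ]⇓ y
    ev-prec0 : ∀ {n} {g : Code n} {h : Code (suc (suc n))} {xs y} →
               O ⊢ g [ xs ]⇓ y → O ⊢ prec g h [ 0 ∷ xs ]⇓ y
    ev-precS : ∀ {n} {g : Code n} {h : Code (suc (suc n))} {k xs y z} →
               O ⊢ prec g h [ k ∷ xs ]⇓ y → O ⊢ h [ k ∷ y ∷ xs ]⇓ z →
               O ⊢ prec g h [ suc k ∷ xs ]⇓ z
    ev-mu   : ∀ {n} {f : Code (suc n)} {xs y} →
              O ⊢ f [ y ∷ xs ]⇓ 0 →
              (∀ z → z < y → Σ ℕ (λ w → O ⊢ f [ z ∷ xs ]⇓ suc w)) →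
              O ⊢ mu f [ xs ]⇓ y
    ev-orc  : ∀ {x b} → O x ≡ just b →
              O ⊢ orc [ x ∷ [] ]⇓ (if b then 1 else 0)

  data _⊢_[_]⇓*_ (O : Oracle) : ∀ {m n} → Vec (Code n) m → Vec ℕ n → Vec ℕ m → Set where
    ev-[] : ∀ {n} {xs : Vec ℕ n} → O ⊢ [] [ xs ]⇓* []
    ev-∷  : ∀ {m n} {g : Code n} {gs : Vec (Code n) m} {xs y ys} →
            O ⊢ g [ xs ]⇓ y → O ⊢ gs [ xs ]⇓* ys → O ⊢ (g ∷ gs) [ xs ]⇓* (y ∷ ys)

Computable : (ℕ → ℕ) → Set
Computable f = Σ (Code 1) λ c → ∀ x → noOracle ⊢ c [ x ∷ [] ]⇓ f x

Computable₃ : (ℕ → ℕ → ℕ → ℕ) → Set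
Computable₃ f = Σ (Code 3) λ c → ∀ x y z → noOracle ⊢ c [ x ∷ y ∷ z ∷ [] ]⇓ f x y z

-- An enumeration of partial functions: φ i x y means φ_i(x) ↓ = y.
Enumeration : Set₁
Enumeration = ℕ → ℕ → ℕ → Set

record Acceptable (φ : Enumeration) : Set where
  field
    universal : Σ (Code 2) λ u →
                  ∀ i x y → (φ i x y → noOracle ⊢ u [ i ∷ x ∷ [] ]⇓ y)
                          × (noOracle ⊢ u [ i ∷ x ∷ [] ]⇓ y → φ i x y)
    smn : ∀ (c : Code 2) → Σ (ℕ → ℕ) λ s → Computable s ×
            (∀ i x y → (φ (s i) x y → noOracle ⊢ c [ i ∷ x ∷ [] ]⇓ y)
                     × (noOracle ⊢ c [ i ∷ x ∷ [] ]⇓ y → φ (s i) x y))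

-- An enumeration of Turing functionals: Φ e O x y means Φ_e^O(x) ↓ = y.
FunctionalEnumeration : Set₁
FunctionalEnumeration = ℕ → Oracle → ℕ → ℕ → Set

record AcceptableF (Φ : FunctionalEnumeration) : Set where
  field
    universal : Σ (Code 2) λ u →
                  ∀ O e x y → (Φ e O x y → O ⊢ u [ e ∷ x ∷ [] ]⇓ y)
                            × (O ⊢ u [ e ∷ x ∷ [] ]⇓ y → Φ e O x y)
    smn : ∀ (c : Code 2) → Σ (ℕ → ℕ) λ s → Computable s ×
            (∀ O i x y → (Φ (s i) O x y → O ⊢ c [ i ∷ x ∷ [] ]⇓ y)
                       × (O ⊢ c [ i ∷ x ∷ [] ]⇓ y → Φ (s i) O x y))

record TripleCoding (t : ℕ → ℕ → ℕ → ℕ) : Set where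
  field
    computable : Computable₃ t
    injective  : ∀ {a b c a' b' c'} → t a b c ≡ t a' b' c' →
                   (a ≡ a') × (b ≡ b') × (c ≡ c')
    surjective : ∀ z → Σ ℕ λ a → Σ ℕ λ b → Σ ℕ λ c → t a b c ≡ z

boundedJump : Enumeration → FunctionalEnumeration → SetN → ℕ → Set
boundedJump φ Φ A x =
  Σ ℕ λ i → i ≤ x × Σ ℕ λ m → φ i x m × Σ ℕ λ y → Φ x (A ↾ m) x y

boundedJump₀ : Enumeration → FunctionalEnumeration → (ℕ → ℕ → ℕ → ℕ) → SetN → ℕ → Set
boundedJump₀ φ Φ t A z =
  Σ ℕ λ e → Σ ℕ λ i → Σ ℕ λ j → z ≡ t e i j ×
    Σ ℕ λ m → φ i j m × Σ ℕ λ y → Φ e (A ↾ m) j y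

_≤₁_ : (ℕ → Set) → (ℕ → Set) → Set
X ≤₁ Y = Σ (ℕ → ℕ) λ f → Computable f × (∀ {a b} → f a ≡ f b → a ≡ b) ×
           (∀ x → (X x → Y (f x)) × (Y (f x) → X x))

module Submission where

-- Given z = ⟨e, i, j⟩ we build, uniformly in z, a Turing functional that ignores its input
-- and simulates Φ_e(j) on the oracle with use bounded by φ_i(j); by s-m-n it has an index
-- f z.  The constant function x ↦ φ_i(j) has, again by s-m-n, some index ψ z, and we pad
-- f z so that ψ z < f z.  Then f z ∈ A^b iff z ∈ A^{b₀}: ψ z ≤ f z is a legitimate bound
-- index for the forward direction, and in the backward direction the simulation itself
-- only consults A ↾ φ_i(j), whatever bound A^b grants.

open import Defs
open import Data.Nat using (ℕ; zero; suc; pred; _≤_; _<_; _≤ᵇ_; _+_; _∸_; z≤n; s≤s)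
open import Data.Nat.Properties
open import Data.Fin using (Fin; toℕ; fromℕ<; inject₁; fromℕ) renaming (zero to fzero; suc to fsuc)
import Data.Fin.Properties as Fin
open import Data.Vec using (Vec; []; _∷_; lookup; _∷ʳ_)
open import Data.Bool using (true; if_then_else_; T)
open import Data.Maybe using (just; nothing)
open import Data.Product using (Σ; _×_; _,_; proj₁; proj₂)
open import Data.Sum using (_⊎_; inj₁; inj₂)
open import Data.Unit using (tt)
open import Function using (case_of_)
open import Function.Bundles using (_⇔_; mk⇔; Equivalence)
open import Relation.Binary.PropositionalEquality hiding (J)
open import Relation.Nullary using (¬_; contradiction)
open import Relation.Binary.Definitions using (tri<; tri≈; tri>)

mutual
  ⇓-det : ∀ {O n} {c : Code n} {xs y y'} →
          O ⊢ c [ xs ]⇓ y → O ⊢ c [ xs ]⇓ y' → y ≡ y'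
  ⇓-det ev-zer ev-zer = refl
  ⇓-det ev-succ ev-succ = refl
  ⇓-det ev-proj ev-proj = refl
  ⇓-det (ev-comp ds d) (ev-comp ds' d') rewrite ⇓*-det ds ds' = ⇓-det d d'
  ⇓-det (ev-prec0 d) (ev-prec0 d') = ⇓-det d d'
  ⇓-det (ev-precS d e) (ev-precS d' e') rewrite ⇓-det d d' = ⇓-det e e'
  -- Of two minimisation results, the smaller would be passed over by the other search.
  ⇓-det {y = y} {y'} (ev-mu zero-at-y below-y) (ev-mu zero-at-y' below-y') with <-cmp y y'
  ... | tri< y<y' _ _ = contradiction (⇓-det zero-at-y (proj₂ (below-y' y y<y'))) 0≢1+n
  ... | tri≈ _ y≡y' _ = y≡y'
  ... | tri> _ _ y'<y = contradiction (⇓-det zero-at-y' (proj₂ (below-y y' y'<y))) 0≢1+n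
  ⇓-det (ev-orc e) (ev-orc e') with trans (sym e) e'
  ... | refl = refl

  ⇓*-det : ∀ {O m n} {gs : Vec (Code n) m} {xs ys ys'} →
           O ⊢ gs [ xs ]⇓* ys → O ⊢ gs [ xs ]⇓* ys' → ys ≡ ys'
  ⇓*-det ev-[] ev-[] = refl
  ⇓*-det (ev-∷ d ds) (ev-∷ d' ds') = cong₂ _∷_ (⇓-det d d') (⇓*-det ds ds')

_⊑_ : Oracle → Oracle → Set
O ⊑ O' = ∀ k b → O k ≡ just b → O' k ≡ just b

mutual
  ⇓-mono : ∀ {O O' n} {c : Code n} {xs y} → O ⊑ O' → O ⊢ c [ xs ]⇓ y → O' ⊢ c [ xs ]⇓ y
  ⇓-mono O⊑O' ev-zer = ev-zer
  ⇓-mono O⊑O' ev-succ = ev-succ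
  ⇓-mono O⊑O' ev-proj = ev-proj
  ⇓-mono O⊑O' (ev-comp ds d) = ev-comp (⇓*-mono O⊑O' ds) (⇓-mono O⊑O' d)
  ⇓-mono O⊑O' (ev-prec0 d) = ev-prec0 (⇓-mono O⊑O' d)
  ⇓-mono O⊑O' (ev-precS d e) = ev-precS (⇓-mono O⊑O' d) (⇓-mono O⊑O' e)
  ⇓-mono O⊑O' (ev-mu d below) =
    ev-mu (⇓-mono O⊑O' d) (λ z z<y → proj₁ (below z z<y) , ⇓-mono O⊑O' (proj₂ (below z z<y)))
  ⇓-mono O⊑O' (ev-orc e) = ev-orc (O⊑O' _ _ e)

  ⇓*-mono : ∀ {O O' m n} {gs : Vec (Code n) m} {xs ys} →
            O ⊑ O' → O ⊢ gs [ xs ]⇓* ys → O' ⊢ gs [ xs ]⇓* ys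
  ⇓*-mono O⊑O' ev-[] = ev-[]
  ⇓*-mono O⊑O' (ev-∷ d ds) = ev-∷ (⇓-mono O⊑O' d) (⇓*-mono O⊑O' ds)

⇓-relativise : ∀ {O n} {c : Code n} {xs y} → noOracle ⊢ c [ xs ]⇓ y → O ⊢ c [ xs ]⇓ y
⇓-relativise = ⇓-mono (λ k b ())

PositiveBelow : (ℕ → ℕ) → ℕ → Set
PositiveBelow F N = ∀ z → z < N → Σ ℕ λ w → F z ≡ suc w

LeastZero : (ℕ → ℕ) → ℕ → Set
LeastZero F y = F y ≡ 0 × PositiveBelow F y

scan : (F : ℕ → ℕ) (N : ℕ) → PositiveBelow F N ⊎ Σ ℕ (LeastZero F)
scan F zero = inj₁ (λ z ())
scan F (suc N) with scan F N
... | inj₂ found = inj₂ found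
... | inj₁ positive with F N in FN
...   | zero = inj₂ (N , FN , positive)
...   | suc w = inj₁ extended
  where
  extended : PositiveBelow F (suc N)
  extended z z<1+N with m<1+n⇒m<n∨m≡n z<1+N
  ... | inj₁ z<N = positive z z<N
  ... | inj₂ refl = w , FN

leastZero : (F : ℕ → ℕ) (y : ℕ) → F y ≡ 0 → Σ ℕ (LeastZero F)
leastZero F y Fy≡0 with scan F (suc y)
... | inj₂ found = found
... | inj₁ positive = contradiction (trans (sym Fy≡0) (proj₂ (positive y (n<1+n y)))) 0≢1+n

mu-computes : ∀ {O n} {f : Code (suc n)} {xs : Vec ℕ n} (F : ℕ → ℕ) →
              (∀ y → O ⊢ f [ y ∷ xs ]⇓ F y) → ∀ {y} → LeastZero F y → O ⊢ mu f [ xs ]⇓ y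
mu-computes {O} {f = f} {xs} F computes {y} (Fy≡0 , positive) =
  ev-mu (subst (O ⊢ f [ y ∷ xs ]⇓_) Fy≡0 (computes y))
        (λ z z<y → proj₁ (positive z z<y) ,
                   subst (O ⊢ f [ z ∷ xs ]⇓_) (proj₂ (positive z z<y)) (computes z))

-- Pigeonhole: an injective g : ℕ → ℕ cannot map 0, …, K into {0, …, K-1}.
injective-unbounded : (g : ℕ → ℕ) → (∀ {p q} → g p ≡ g q → p ≡ q) →
                      ∀ K → ¬ (∀ p → p < suc K → g p < K)
injective-unbounded g g-inj K below =
  case Fin.pigeonhole (n<1+n K) squeeze of λ where
    (i , j , i<j , same) → <⇒≢ i<j (g-inj (collision same))
  where
  squeeze : Fin (suc K) → Fin K
  squeeze i = fromℕ< (below (toℕ i) (Fin.toℕ<n i))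

  collision : ∀ {i j} → squeeze i ≡ squeeze j → g (toℕ i) ≡ g (toℕ j)
  collision {i} {j} same = begin
    g (toℕ i)          ≡⟨ Fin.toℕ-fromℕ< (below (toℕ i) (Fin.toℕ<n i)) ⟨
    toℕ (squeeze i)    ≡⟨ cong toℕ same ⟩
    toℕ (squeeze j)    ≡⟨ Fin.toℕ-fromℕ< (below (toℕ j) (Fin.toℕ<n j)) ⟩
    g (toℕ j)          ∎
    where open ≡-Reasoning

-- Hence an injective g exceeds every bound K, and there is a least p with K ≤ g p.
leastExceeding : (g : ℕ → ℕ) → (∀ {p q} → g p ≡ g q → p ≡ q) →
                 ∀ K → Σ ℕ (LeastZero (λ p → K ∸ g p))
leastExceeding g g-inj K with scan (λ p → K ∸ g p) (suc K)
... | inj₂ found = found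
... | inj₁ positive = contradiction below (injective-unbounded g g-inj K)
  where
  below : ∀ p → p < suc K → g p < K
  below p p<1+K = m∸n≢0⇒n<m (λ eq → 0≢1+n (trans (sym eq) (proj₂ (positive p p<1+K))))

-- A small library of codes.  By convention fooC is a code and fooC-computes states that it
-- computes foo relative to every oracle (these codes never query it).

p0 : ∀ {n} → Code (suc n)
p0 = proj fzero

p1 : ∀ {n} → Code (suc (suc n))
p1 = proj (fsuc fzero)

-- μy. y + 1 = 0 : a code that halts on no input.
diverge : ∀ {n} → Code n
diverge = mu (comp succ (p0 ∷ []))

diverge-never : ∀ {O n} {xs : Vec ℕ n} {y} → ¬ (O ⊢ diverge [ xs ]⇓ y)
diverge-never (ev-mu (ev-comp (ev-∷ ev-proj ev-[]) ()) _)

predC : Code 1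
predC = prec zer p0

predC-computes : ∀ {O} x → O ⊢ predC [ x ∷ [] ]⇓ pred x
predC-computes zero = ev-prec0 ev-zer
predC-computes (suc x) = ev-precS (predC-computes x) ev-proj

-- Truncated subtraction, by recursion on the subtrahend: [b, a] ↦ a ∸ b.
monusByC : Code 2
monusByC = prec p0 (comp predC (p1 ∷ []))

monusByC-computes : ∀ {O} a b → O ⊢ monusByC [ b ∷ a ∷ [] ]⇓ (a ∸ b)
monusByC-computes a zero = ev-prec0 ev-proj
monusByC-computes {O} a (suc b) = ev-precS (monusByC-computes a b)
  (subst (O ⊢ comp predC (p1 ∷ []) [ b ∷ a ∸ b ∷ a ∷ [] ]⇓_)
     (pred[m∸n]≡m∸[1+n] a b) (ev-comp (ev-∷ ev-proj ev-[]) (predC-computes (a ∸ b))))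

monusC : Code 2
monusC = comp monusByC (p1 ∷ p0 ∷ [])

monusC-computes : ∀ {O} a b → O ⊢ monusC [ a ∷ b ∷ [] ]⇓ (a ∸ b)
monusC-computes a b = ev-comp (ev-∷ ev-proj (ev-∷ ev-proj ev-[])) (monusByC-computes a b)

addC : Code 2
addC = prec p0 (comp succ (p1 ∷ []))

addC-computes : ∀ {O} a b → O ⊢ addC [ a ∷ b ∷ [] ]⇓ (a + b)
addC-computes zero b = ev-prec0 ev-proj
addC-computes (suc a) b = ev-precS (addC-computes a b) (ev-comp (ev-∷ ev-proj ev-[]) ev-succ)

-- [d, k] ↦ k if d = 0, divergence otherwise.
haltIfZeroC : Code 2
haltIfZeroC = prec p0 diverge

-- The guard [k, p] ↦ k, defined exactly when k < p (computed as haltIfZero (k+1 ∸ p, k)).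
guardC : Code 2
guardC = comp haltIfZeroC (comp monusC (comp succ (p0 ∷ []) ∷ p1 ∷ []) ∷ p0 ∷ [])

guardC-computes : ∀ {O} k p → k < p → O ⊢ guardC [ k ∷ p ∷ [] ]⇓ k
guardC-computes {O} k p k<p =
  ev-comp (ev-∷ excess≡0 (ev-∷ ev-proj ev-[])) (ev-prec0 ev-proj)
  where
  excess≡0 : O ⊢ comp monusC (comp succ (p0 ∷ []) ∷ p1 ∷ []) [ k ∷ p ∷ [] ]⇓ 0
  excess≡0 = ev-comp (ev-∷ (ev-comp (ev-∷ ev-proj ev-[]) ev-succ) (ev-∷ ev-proj ev-[]))
    (subst (O ⊢ monusC [ suc k ∷ p ∷ [] ]⇓_) (m≤n⇒m∸n≡0 k<p) (monusC-computes (suc k) p))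

guardC-halts : ∀ {O} k p {y} → O ⊢ guardC [ k ∷ p ∷ [] ]⇓ y → k < p × y ≡ k
guardC-halts k p (ev-comp (ev-∷ (ev-comp (ev-∷ (ev-comp (ev-∷ ev-proj ev-[]) ev-succ)
                  (ev-∷ ev-proj ev-[])) excess) (ev-∷ ev-proj ev-[])) (ev-prec0 ev-proj)) =
  m∸n≡0⇒m≤n (⇓-det (monusC-computes (suc k) p) excess) , refl
guardC-halts k p (ev-comp _ (ev-precS _ diverging)) = contradiction diverging diverge-never

distance : ℕ → ℕ → ℕ
distance a b = (a ∸ b) + (b ∸ a)

distanceC : Code 2
distanceC = comp addC (monusC ∷ comp monusC (p1 ∷ p0 ∷ []) ∷ [])

distanceC-computes : ∀ {O} a b → O ⊢ distanceC [ a ∷ b ∷ [] ]⇓ distance a b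
distanceC-computes a b =
  ev-comp (ev-∷ (monusC-computes a b)
          (ev-∷ (ev-comp (ev-∷ ev-proj (ev-∷ ev-proj ev-[])) (monusC-computes b a)) ev-[]))
          (addC-computes _ _)

distance-self : ∀ a → distance a a ≡ 0
distance-self a rewrite n∸n≡0 a = refl

distance≡0 : ∀ {a b} → distance a b ≡ 0 → a ≡ b
distance≡0 {a} {b} d≡0 =
  ≤-antisym (m∸n≡0⇒m≤n (m+n≡0⇒m≡0 (a ∸ b) d≡0)) (m∸n≡0⇒m≤n (m+n≡0⇒n≡0 (a ∸ b) d≡0))

tri : ℕ → ℕ
tri zero = 0
tri (suc r) = tri r + suc r

tri-mono : ∀ {r s} → r ≤ s → tri r ≤ tri s
tri-mono {s = zero} z≤n = ≤-refl
tri-mono {r} {suc s} r≤1+s with m≤n⇒m<n∨m≡n r≤1+s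
... | inj₂ refl = ≤-refl
... | inj₁ (s≤s r≤s) = ≤-trans (tri-mono r≤s) (m≤m+n (tri s) (suc s))

triC : Code 1
triC = prec zer (comp addC (p1 ∷ comp succ (p0 ∷ []) ∷ []))

triC-computes : ∀ {O} r → O ⊢ triC [ r ∷ [] ]⇓ tri r
triC-computes zero = ev-prec0 ev-zer
triC-computes (suc r) = ev-precS (triC-computes r)
  (ev-comp (ev-∷ ev-proj (ev-∷ (ev-comp (ev-∷ ev-proj ev-[]) ev-succ) ev-[]))
           (addC-computes (tri r) (suc r)))

-- Cantor pairing: (a, b) sits at position a on the diagonal a + b.
pair : ℕ → ℕ → ℕ
pair a b = tri (a + b) + a

pairC : Code 2
pairC = comp addC (comp triC (addC ∷ []) ∷ p0 ∷ [])

pairC-computes : ∀ {O} a b → O ⊢ pairC [ a ∷ b ∷ [] ]⇓ pair a b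
pairC-computes a b =
  ev-comp (ev-∷ (ev-comp (ev-∷ (addC-computes a b) ev-[]) (triC-computes (a + b)))
          (ev-∷ ev-proj ev-[]))
          (addC-computes _ _)

-- The diagonal through n is the least r with n < tri (r + 1).
beyond : ℕ → ℕ → ℕ
beyond n r = suc n ∸ tri (suc r)

beyondC : Code 2
beyondC = comp monusC (comp succ (p1 ∷ []) ∷ comp triC (comp succ (p0 ∷ []) ∷ []) ∷ [])

beyondC-computes : ∀ {O} n r → O ⊢ beyondC [ r ∷ n ∷ [] ]⇓ beyond n r
beyondC-computes n r =
  ev-comp (ev-∷ (ev-comp (ev-∷ ev-proj ev-[]) ev-succ)
          (ev-∷ (ev-comp (ev-∷ (ev-comp (ev-∷ ev-proj ev-[]) ev-succ) ev-[])
                         (triC-computes (suc r))) ev-[]))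
          (monusC-computes (suc n) (tri (suc r)))

-- The search succeeds since n < tri (n + 1).  Only the specification of its result matters,
-- so the construction is kept opaque.
abstract
  diagonal-exists : ∀ n → Σ ℕ (LeastZero (beyond n))
  diagonal-exists n = leastZero (beyond n) n (m≤n⇒m∸n≡0 (m≤n+m (suc n) (tri n)))

diagonal : ℕ → ℕ
diagonal n = proj₁ (diagonal-exists n)

diagonalC : Code 1
diagonalC = mu beyondC

diagonalC-computes : ∀ {O} n → O ⊢ diagonalC [ n ∷ [] ]⇓ diagonal n
diagonalC-computes n = mu-computes (beyond n) (beyondC-computes n) (proj₂ (diagonal-exists n))

diagonal-unique : ∀ n r → tri r ≤ n → n < tri (suc r) → diagonal n ≡ r
diagonal-unique n r tri-r≤n n<tri-1+r with diagonal-exists n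
... | d , beyond≡0 , positive with <-cmp d r
... | tri≈ _ d≡r _ = d≡r
... | tri< d<r _ _ = contradiction (≤-trans (tri-mono d<r) tri-r≤n) (<⇒≱ (m∸n≡0⇒m≤n beyond≡0))
... | tri> _ _ r<d =
  contradiction (trans (sym (m≤n⇒m∸n≡0 n<tri-1+r)) (proj₂ (positive r r<d))) 0≢1+n

unpairFst : ℕ → ℕ
unpairFst n = n ∸ tri (diagonal n)

unpairSnd : ℕ → ℕ
unpairSnd n = diagonal n ∸ unpairFst n

unpairFstC : Code 1
unpairFstC = comp monusC (p0 ∷ comp triC (diagonalC ∷ []) ∷ [])

unpairSndC : Code 1
unpairSndC = comp monusC (diagonalC ∷ unpairFstC ∷ [])

unpairFstC-computes : ∀ {O} n → O ⊢ unpairFstC [ n ∷ [] ]⇓ unpairFst n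
unpairFstC-computes n =
  ev-comp (ev-∷ ev-proj (ev-∷ (ev-comp (ev-∷ (diagonalC-computes n) ev-[])
                                       (triC-computes (diagonal n))) ev-[]))
          (monusC-computes _ _)

unpairSndC-computes : ∀ {O} n → O ⊢ unpairSndC [ n ∷ [] ]⇓ unpairSnd n
unpairSndC-computes n =
  ev-comp (ev-∷ (diagonalC-computes n) (ev-∷ (unpairFstC-computes n) ev-[]))
          (monusC-computes _ _)

diagonal-pair : ∀ a b → diagonal (pair a b) ≡ a + b
diagonal-pair a b = diagonal-unique (pair a b) (a + b) (m≤m+n (tri (a + b)) a) pair<next
  where
  pair<next : pair a b < tri (suc (a + b))
  pair<next = begin-strict
    tri (a + b) + a         <⟨ +-monoʳ-< (tri (a + b)) (s≤s (m≤m+n a b)) ⟩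
    tri (a + b) + suc (a + b) ≡⟨⟩
    tri (suc (a + b))       ∎
    where open ≤-Reasoning

unpairFst-pair : ∀ a b → unpairFst (pair a b) ≡ a
unpairFst-pair a b rewrite diagonal-pair a b = m+n∸m≡n (tri (a + b)) a

unpairSnd-pair : ∀ a b → unpairSnd (pair a b) ≡ b
unpairSnd-pair a b rewrite unpairFst-pair a b | diagonal-pair a b = m+n∸m≡n a b

restrict : Oracle → ℕ → Oracle
restrict O p k = if suc k ≤ᵇ p then O k else nothing

restrict-answer : ∀ O p k {b} → restrict O p k ≡ just b → k < p × O k ≡ just b
restrict-answer O p k answer with suc k ≤ᵇ p in k<ᵇp
... | true = ≤ᵇ⇒≤ (suc k) p (subst T (sym k<ᵇp) tt) , answer

restrict-query : ∀ O p k {b} → k < p → O k ≡ just b → restrict O p k ≡ just b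
restrict-query O p k k<p answer with suc k ≤ᵇ p | ≤⇒≤ᵇ k<p
... | true | _ = answer

restrict-0 : ∀ O → restrict O 0 ⊑ noOracle
restrict-0 O k b answer with () ← proj₁ (restrict-answer O 0 k answer)

lookup-init : ∀ {n} {p : ℕ} (xs : Vec ℕ n) i → lookup (xs ∷ʳ p) (inject₁ i) ≡ lookup xs i
lookup-init (x ∷ xs) fzero = refl
lookup-init (x ∷ xs) (fsuc i) = lookup-init xs i

lookup-last : ∀ {n} {p : ℕ} (xs : Vec ℕ n) → lookup (xs ∷ʳ p) (fromℕ n) ≡ p
lookup-last [] = refl
lookup-last (x ∷ xs) = lookup-last xs

-- useBounded c takes an extra last argument p and runs c, diverging at every oracle
-- query k ≥ p: each query passes through the guard [k, p] ↦ k.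
mutual
  useBounded : ∀ {n} → Code n → Code (suc n)
  useBounded zer = zer
  useBounded succ = comp succ (p0 ∷ [])
  useBounded (proj i) = proj (inject₁ i)
  useBounded (comp f gs) = comp (useBounded f) (useBounded* gs)
  useBounded (prec g h) = prec (useBounded g) (useBounded h)
  useBounded (mu f) = mu (useBounded f)
  useBounded orc = comp orc (guardC ∷ [])

  -- Each code of a composition is bounded, and the bound itself is passed on as the last argument.
  useBounded* : ∀ {m n} → Vec (Code n) m → Vec (Code (suc n)) (suc m)
  useBounded* {n = n} [] = proj (fromℕ n) ∷ []
  useBounded* (g ∷ gs) = useBounded g ∷ useBounded* gs

mutual
  useBounded-sound : ∀ {O n p} (c : Code n) {xs y} →
                     O ⊢ useBounded c [ xs ∷ʳ p ]⇓ y → restrict O p ⊢ c [ xs ]⇓ y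
  useBounded-sound zer ev-zer = ev-zer
  useBounded-sound succ {x ∷ []} (ev-comp (ev-∷ ev-proj ev-[]) ev-succ) = ev-succ
  useBounded-sound {O} {p = p} (proj i) {xs} ev-proj =
    subst (restrict O p ⊢ proj i [ xs ]⇓_) (sym (lookup-init xs i)) ev-proj
  useBounded-sound (comp f gs) (ev-comp ds d) with useBounded*-sound gs ds
  ... | ys , refl , ds' = ev-comp ds' (useBounded-sound f d)
  useBounded-sound (prec g h) {zero ∷ xs} (ev-prec0 d) = ev-prec0 (useBounded-sound g d)
  useBounded-sound (prec g h) {suc k ∷ xs} (ev-precS d e) =
    ev-precS (useBounded-sound (prec g h) d) (useBounded-sound h e)
  useBounded-sound (mu f) (ev-mu d below) =
    ev-mu (useBounded-sound f d)
          (λ z z<y → proj₁ (below z z<y) , useBounded-sound f (proj₂ (below z z<y)))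
  useBounded-sound {O} {p = p} orc {k ∷ []} (ev-comp (ev-∷ guarded ev-[]) (ev-orc answer))
    with guardC-halts k p guarded
  ... | k<p , refl = ev-orc (restrict-query O p k k<p answer)

  useBounded*-sound : ∀ {O m n p} (gs : Vec (Code n) m) {xs ys'} →
                      O ⊢ useBounded* gs [ xs ∷ʳ p ]⇓* ys' →
                      Σ (Vec ℕ m) λ ys → ys' ≡ ys ∷ʳ p × restrict O p ⊢ gs [ xs ]⇓* ys
  useBounded*-sound [] {xs} (ev-∷ ev-proj ev-[]) = [] , cong (_∷ []) (lookup-last xs) , ev-[]
  useBounded*-sound (g ∷ gs) (ev-∷ d ds) with useBounded*-sound gs ds
  ... | ys , refl , ds' = (_ ∷ ys) , refl , ev-∷ (useBounded-sound g d) ds'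

mutual
  useBounded-complete : ∀ {O n p} {c : Code n} {xs y} →
                        restrict O p ⊢ c [ xs ]⇓ y → O ⊢ useBounded c [ xs ∷ʳ p ]⇓ y
  useBounded-complete ev-zer = ev-zer
  useBounded-complete ev-succ = ev-comp (ev-∷ ev-proj ev-[]) ev-succ
  useBounded-complete {O} {p = p} {xs = xs} (ev-proj {i = i}) =
    subst (O ⊢ proj (inject₁ i) [ xs ∷ʳ p ]⇓_) (lookup-init xs i) ev-proj
  useBounded-complete (ev-comp ds d) = ev-comp (useBounded*-complete ds) (useBounded-complete d)
  useBounded-complete (ev-prec0 d) = ev-prec0 (useBounded-complete d)
  useBounded-complete (ev-precS d e) = ev-precS (useBounded-complete d) (useBounded-complete e)
  useBounded-complete (ev-mu d below) =
    ev-mu (useBounded-complete d)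
          (λ z z<y → proj₁ (below z z<y) , useBounded-complete (proj₂ (below z z<y)))
  useBounded-complete {O} {p = p} (ev-orc {x = k} answer) with restrict-answer O p k answer
  ... | k<p , answer' = ev-comp (ev-∷ (guardC-computes k p k<p) ev-[]) (ev-orc answer')

  useBounded*-complete : ∀ {O m n p} {gs : Vec (Code n) m} {xs ys} →
                         restrict O p ⊢ gs [ xs ]⇓* ys → O ⊢ useBounded* gs [ xs ∷ʳ p ]⇓* (ys ∷ʳ p)
  useBounded*-complete {O} {n = n} {p} {xs = xs} ev-[] =
    ev-∷ (subst (O ⊢ proj (fromℕ n) [ xs ∷ʳ p ]⇓_) (lookup-last xs) ev-proj) ev-[]
  useBounded*-complete (ev-∷ d ds) = ev-∷ (useBounded-complete d) (useBounded*-complete ds)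

-- n read as a triple: n = pair a (pair b c).
fst₃ snd₃ thd₃ : ℕ → ℕ
fst₃ n = unpairFst n
snd₃ n = unpairFst (unpairSnd n)
thd₃ n = unpairSnd (unpairSnd n)

-- Every computable surjection t : ℕ³ → ℕ has a computable right inverse, found by
-- μ-searching for the least n whose triple is mapped to z.
module RightInverse (t : ℕ → ℕ → ℕ → ℕ) (t-computable : Computable₃ t)
                    (t-surjective : ∀ z → Σ ℕ λ a → Σ ℕ λ b → Σ ℕ λ c → t a b c ≡ z) where

  tC : Code 3
  tC = proj₁ t-computable

  mismatch : ℕ → ℕ → ℕ
  mismatch z n = distance (t (fst₃ n) (snd₃ n) (thd₃ n)) z

  mismatchC : Code 2
  mismatchC = comp distanceC (comp tC (comp unpairFstC (p0 ∷ []) ∷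
                                       comp unpairFstC (comp unpairSndC (p0 ∷ []) ∷ []) ∷
                                       comp unpairSndC (comp unpairSndC (p0 ∷ []) ∷ []) ∷ []) ∷
                              p1 ∷ [])

  mismatchC-computes : ∀ {O} z n → O ⊢ mismatchC [ n ∷ z ∷ [] ]⇓ mismatch z n
  mismatchC-computes z n =
    ev-comp (ev-∷ (ev-comp (ev-∷ (ev-comp (ev-∷ ev-proj ev-[]) (unpairFstC-computes n))
                           (ev-∷ (ev-comp (ev-∷ rest ev-[]) (unpairFstC-computes _))
                           (ev-∷ (ev-comp (ev-∷ rest ev-[]) (unpairSndC-computes _)) ev-[])))
                           (⇓-relativise (proj₂ t-computable _ _ _)))
            (ev-∷ ev-proj ev-[]))
            (distanceC-computes _ _)
    where
    rest : ∀ {O} → O ⊢ comp unpairSndC (p0 ∷ []) [ n ∷ z ∷ [] ]⇓ unpairSnd n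
    rest = ev-comp (ev-∷ ev-proj ev-[]) (unpairSndC-computes n)

  abstract
    search : ∀ z → Σ ℕ (LeastZero (mismatch z))
    search z with t-surjective z
    ... | a , b , c , tabc≡z = leastZero (mismatch z) (pair a (pair b c)) hit
      where
      n : ℕ
      n = pair a (pair b c)

      decodes : t (fst₃ n) (snd₃ n) (thd₃ n) ≡ z
      decodes = begin
        t (fst₃ n) (snd₃ n) (thd₃ n)
          ≡⟨ cong₂ (λ x y → t x (unpairFst y) (unpairSnd y))
                   (unpairFst-pair a (pair b c)) (unpairSnd-pair a (pair b c)) ⟩
        t a (unpairFst (pair b c)) (unpairSnd (pair b c))
          ≡⟨ cong₂ (t a) (unpairFst-pair b c) (unpairSnd-pair b c) ⟩
        t a b c
          ≡⟨ tabc≡z ⟩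
        z ∎
        where open ≡-Reasoning

      hit : mismatch z n ≡ 0
      hit = trans (cong (λ x → distance x z) decodes) (distance-self z)

  preimage : ℕ → ℕ
  preimage z = proj₁ (search z)

  preimageC : Code 1
  preimageC = mu mismatchC

  preimageC-computes : ∀ {O} z → O ⊢ preimageC [ z ∷ [] ]⇓ preimage z
  preimageC-computes z = mu-computes (mismatch z) (mismatchC-computes z) (proj₂ (search z))

  E I J : ℕ → ℕ
  E z = fst₃ (preimage z)
  I z = snd₃ (preimage z)
  J z = thd₃ (preimage z)

  EC IC JC : Code 1
  EC = comp unpairFstC (preimageC ∷ [])
  IC = comp unpairFstC (comp unpairSndC (preimageC ∷ []) ∷ [])
  JC = comp unpairSndC (comp unpairSndC (preimageC ∷ []) ∷ [])

  EC-computes : ∀ {O} z → O ⊢ EC [ z ∷ [] ]⇓ E z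
  EC-computes z = ev-comp (ev-∷ (preimageC-computes z) ev-[]) (unpairFstC-computes _)

  IC-computes : ∀ {O} z → O ⊢ IC [ z ∷ [] ]⇓ I z
  IC-computes z =
    ev-comp (ev-∷ (ev-comp (ev-∷ (preimageC-computes z) ev-[]) (unpairSndC-computes _)) ev-[])
            (unpairFstC-computes _)

  JC-computes : ∀ {O} z → O ⊢ JC [ z ∷ [] ]⇓ J z
  JC-computes z =
    ev-comp (ev-∷ (ev-comp (ev-∷ (preimageC-computes z) ev-[]) (unpairSndC-computes _)) ev-[])
            (unpairSndC-computes _)

  right-inverse : ∀ z → t (E z) (I z) (J z) ≡ z
  right-inverse z = distance≡0 (proj₁ (proj₂ (search z)))

↾-answer : ∀ A n k {b} → (A ↾ n) k ≡ just b → k ≤ n × A k ≡ b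
↾-answer A n k answer with k ≤ᵇ n in k≤ᵇn
↾-answer A n k refl | true = ≤ᵇ⇒≤ k n (subst T (sym k≤ᵇn) tt) , refl

↾-query : ∀ A n k → k ≤ n → (A ↾ n) k ≡ just (A k)
↾-query A n k k≤n with k ≤ᵇ n | ≤⇒≤ᵇ k≤n
... | true | _ = refl

↾⊑restrict : ∀ A m → (A ↾ m) ⊑ restrict (A ↾ m) (suc m)
↾⊑restrict A m k b answer =
  restrict-query (A ↾ m) (suc m) k (s≤s (proj₁ (↾-answer A m k answer))) answer

restrict⊑↾ : ∀ A m m' → restrict (A ↾ m') (suc m) ⊑ (A ↾ m)
restrict⊑↾ A m m' k b answer with restrict-answer (A ↾ m') (suc m) k answer
... | s≤s k≤m , answer' with ↾-answer A m' k answer'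
... | _ , refl = ↾-query A m k k≤m

module Reduction (φ : Enumeration) (φ-acceptable : Acceptable φ)
                 (Φ : FunctionalEnumeration) (Φ-acceptable : AcceptableF Φ)
                 (t : ℕ → ℕ → ℕ → ℕ) (t-coding : TripleCoding t) where

  open TripleCoding t-coding using (computable; injective; surjective)
  open RightInverse t computable surjective
  module Aφ = Acceptable φ-acceptable
  module AΦ = AcceptableF Φ-acceptable

  -- Since t is injective, E, I, J recover the components of ⟨e, i, j⟩.
  decode : ∀ (P : ℕ → ℕ → ℕ → Set) {e i j} → P e i j →
           P (E (t e i j)) (I (t e i j)) (J (t e i j))
  decode P {e} {i} {j} Peij with injective (right-inverse (t e i j))
  ... | E≡e , I≡i , J≡j rewrite E≡e | I≡i | J≡j = Peij

  uφ : Code 2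
  uφ = proj₁ Aφ.universal

  uΦ : Code 2
  uΦ = proj₁ AΦ.universal

  -- z ↦ φ_{I z}(J z), by the universal code run with use bound 0 so that it ignores any oracle.
  boundC : Code 1
  boundC = comp (useBounded uφ) (IC ∷ JC ∷ zer ∷ [])

  boundC-intro : ∀ {O} z {m} → φ (I z) (J z) m → O ⊢ boundC [ z ∷ [] ]⇓ m
  boundC-intro z {m} φ↓ =
    ev-comp (ev-∷ (IC-computes z) (ev-∷ (JC-computes z) (ev-∷ ev-zer ev-[])))
            (useBounded-complete {p = 0}
               (⇓-relativise (proj₁ (proj₂ Aφ.universal (I z) (J z) m) φ↓)))

  boundC-elim : ∀ {O} z {m} → O ⊢ boundC [ z ∷ [] ]⇓ m → φ (I z) (J z) m
  boundC-elim {O} z {m} (ev-comp (ev-∷ I↓ (ev-∷ J↓ (ev-∷ ev-zer ev-[]))) u↓)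
    with ⇓-det (IC-computes z) I↓ | ⇓-det (JC-computes z) J↓
  ... | refl | refl =
    proj₂ (proj₂ Aφ.universal (I z) (J z) m)
          (⇓-mono (restrict-0 O) (useBounded-sound uφ {I z ∷ J z ∷ []} u↓))

  -- ψ z is a φ-index of the constant function x ↦ φ_{I z}(J z) (s-m-n theorem).
  constantBoundC : Code 2
  constantBoundC = comp boundC (p0 ∷ [])

  ψ : ℕ → ℕ
  ψ = proj₁ (Aφ.smn constantBoundC)

  ψC : Code 1
  ψC = proj₁ (proj₁ (proj₂ (Aφ.smn constantBoundC)))

  ψC-computes : ∀ {O} z → O ⊢ ψC [ z ∷ [] ]⇓ ψ z
  ψC-computes z = ⇓-relativise (proj₂ (proj₁ (proj₂ (Aφ.smn constantBoundC))) z)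

  ψ-index : ∀ z x {m} → φ (I z) (J z) m → φ (ψ z) x m
  ψ-index z x {m} φ↓ =
    proj₂ (proj₂ (proj₂ (Aφ.smn constantBoundC)) z x m)
          (ev-comp (ev-∷ ev-proj ev-[]) (boundC-intro z φ↓))

  firstOfPair : ∀ {O} z p → O ⊢ unpairFstC [ pair z p ∷ [] ]⇓ z
  firstOfPair {O} z p = subst (O ⊢ unpairFstC [ pair z p ∷ [] ]⇓_) (unpairFst-pair z p)
                              (unpairFstC-computes (pair z p))

  -- pair z p ↦ Φ_{E z}(J z) with use bounded by φ_{I z}(J z): the oracle is queried
  -- only below φ_{I z}(J z) + 1, i.e. as A ↾ φ_{I z}(J z) when the oracle is A.
  simulateC : Code 1
  simulateC = comp (useBounded uΦ) (comp EC (unpairFstC ∷ []) ∷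
                                    comp JC (unpairFstC ∷ []) ∷
                                    comp succ (comp boundC (unpairFstC ∷ []) ∷ []) ∷ [])

  simulateC-intro : ∀ {O} z p {m y} → φ (I z) (J z) m →
                    restrict O (suc m) ⊢ uΦ [ E z ∷ J z ∷ [] ]⇓ y →
                    O ⊢ simulateC [ pair z p ∷ [] ]⇓ y
  simulateC-intro z p φ↓ Φ↓ =
    ev-comp (ev-∷ (ev-comp (ev-∷ (firstOfPair z p) ev-[]) (EC-computes z))
            (ev-∷ (ev-comp (ev-∷ (firstOfPair z p) ev-[]) (JC-computes z))
            (ev-∷ (ev-comp (ev-∷ (ev-comp (ev-∷ (firstOfPair z p) ev-[]) (boundC-intro z φ↓))
                                 ev-[]) ev-succ) ev-[])))
            (useBounded-complete Φ↓)

  simulateC-elim : ∀ {O} z p {y} → O ⊢ simulateC [ pair z p ∷ [] ]⇓ y →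
                   Σ ℕ λ m → φ (I z) (J z) m × restrict O (suc m) ⊢ uΦ [ E z ∷ J z ∷ [] ]⇓ y
  simulateC-elim z p
    (ev-comp (ev-∷ (ev-comp (ev-∷ z↓ ev-[]) E↓)
             (ev-∷ (ev-comp (ev-∷ z↓' ev-[]) J↓)
             (ev-∷ (ev-comp (ev-∷ (ev-comp (ev-∷ z↓'' ev-[]) bound↓) ev-[]) ev-succ) ev-[])))
             u↓)
    with ⇓-det (firstOfPair z p) z↓ | ⇓-det (firstOfPair z p) z↓' | ⇓-det (firstOfPair z p) z↓''
  ... | refl | refl | refl with ⇓-det (EC-computes z) E↓ | ⇓-det (JC-computes z) J↓
  ... | refl | refl = _ , boundC-elim z bound↓ , useBounded-sound uΦ {E z ∷ J z ∷ []} u↓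

  -- [x, v] ↦ v if x = 0, and simulate v otherwise.
  selectByC : Code 2
  selectByC = prec p0 (comp simulateC (proj (fsuc (fsuc fzero)) ∷ []))

  selectC : Code 2
  selectC = comp selectByC (p1 ∷ p0 ∷ [])

  selectC-0 : ∀ {O} v → O ⊢ selectC [ v ∷ 0 ∷ [] ]⇓ v
  selectC-0 v = ev-comp (ev-∷ ev-proj (ev-∷ ev-proj ev-[])) (ev-prec0 ev-proj)

  selectByC-suc : ∀ {O} v k {y} → O ⊢ simulateC [ v ∷ [] ]⇓ y → O ⊢ selectByC [ suc k ∷ v ∷ [] ]⇓ y
  selectByC-suc v zero sim = ev-precS (ev-prec0 ev-proj) (ev-comp (ev-∷ ev-proj ev-[]) sim)
  selectByC-suc v (suc k) sim = ev-precS (selectByC-suc v k sim) (ev-comp (ev-∷ ev-proj ev-[]) sim)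

  selectC-intro : ∀ {O} v x {y} → 0 < x → O ⊢ simulateC [ v ∷ [] ]⇓ y → O ⊢ selectC [ v ∷ x ∷ [] ]⇓ y
  selectC-intro v (suc k) _ sim = ev-comp (ev-∷ ev-proj (ev-∷ ev-proj ev-[])) (selectByC-suc v k sim)

  selectC-elim : ∀ {O} v x {y} → 0 < x → O ⊢ selectC [ v ∷ x ∷ [] ]⇓ y → O ⊢ simulateC [ v ∷ [] ]⇓ y
  selectC-elim v (suc k) _
    (ev-comp (ev-∷ ev-proj (ev-∷ ev-proj ev-[])) (ev-precS _ (ev-comp (ev-∷ ev-proj ev-[]) sim))) = sim

  S : ℕ → ℕ
  S = proj₁ (AΦ.smn selectC)

  SC : Code 1
  SC = proj₁ (proj₁ (proj₂ (AΦ.smn selectC)))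

  SC-computes : ∀ {O} v → O ⊢ SC [ v ∷ [] ]⇓ S v
  SC-computes v = ⇓-relativise (proj₂ (proj₁ (proj₂ (AΦ.smn selectC))) v)

  S-sound : ∀ {O} v x {y} → Φ (S v) O x y → O ⊢ selectC [ v ∷ x ∷ [] ]⇓ y
  S-sound {O} v x {y} = proj₁ (proj₂ (proj₂ (AΦ.smn selectC)) O v x y)

  S-complete : ∀ {O} v x {y} → O ⊢ selectC [ v ∷ x ∷ [] ]⇓ y → Φ (S v) O x y
  S-complete {O} v x {y} = proj₂ (proj₂ (proj₂ (AΦ.smn selectC)) O v x y)

  -- S is injective, since Φ_{S v}(0) = v.
  S-injective : ∀ {v v'} → S v ≡ S v' → v ≡ v'
  S-injective {v} {v'} Sv≡Sv' =
    ⇓-det (S-sound v' 0 (subst (λ s → Φ s noOracle 0 v) Sv≡Sv' (S-complete v 0 (selectC-0 v))))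
          (selectC-0 v')

  -- Padding: among the indices S (pair z p), p = 0, 1, …, pick the first exceeding ψ z.
  excess : ℕ → ℕ → ℕ
  excess z p = suc (ψ z) ∸ S (pair z p)

  excessC : Code 2
  excessC = comp monusC (comp succ (comp ψC (p1 ∷ []) ∷ []) ∷
                         comp SC (comp pairC (p1 ∷ p0 ∷ []) ∷ []) ∷ [])

  excessC-computes : ∀ {O} z p → O ⊢ excessC [ p ∷ z ∷ [] ]⇓ excess z p
  excessC-computes z p =
    ev-comp (ev-∷ (ev-comp (ev-∷ (ev-comp (ev-∷ ev-proj ev-[]) (ψC-computes z)) ev-[]) ev-succ)
            (ev-∷ (ev-comp (ev-∷ (ev-comp (ev-∷ ev-proj (ev-∷ ev-proj ev-[])) (pairC-computes z p))
                                 ev-[]) (SC-computes _)) ev-[]))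
            (monusC-computes _ _)

  abstract
    pad-exists : ∀ z → Σ ℕ (LeastZero (excess z))
    pad-exists z = leastExceeding (λ p → S (pair z p)) injective-in-p (suc (ψ z))
      where
      injective-in-p : ∀ {p q} → S (pair z p) ≡ S (pair z q) → p ≡ q
      injective-in-p {p} {q} same = begin
        p                      ≡⟨ unpairSnd-pair z p ⟨
        unpairSnd (pair z p)   ≡⟨ cong unpairSnd (S-injective same) ⟩
        unpairSnd (pair z q)   ≡⟨ unpairSnd-pair z q ⟩
        q                      ∎
        where open ≡-Reasoning

  pad : ℕ → ℕ
  pad z = proj₁ (pad-exists z)

  f : ℕ → ℕ
  f z = S (pair z (pad z))

  f-computable : Computable f
  f-computable = comp SC (comp pairC (p0 ∷ mu excessC ∷ []) ∷ []) , λ z →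
    ev-comp (ev-∷ (ev-comp (ev-∷ ev-proj (ev-∷ pad↓ ev-[])) (pairC-computes _ _)) ev-[])
            (SC-computes _)
    where
    pad↓ : ∀ {z} → noOracle ⊢ mu excessC [ z ∷ [] ]⇓ pad z
    pad↓ {z} = mu-computes (excess z) (excessC-computes z) (proj₂ (pad-exists z))

  f-injective : ∀ {a b} → f a ≡ f b → a ≡ b
  f-injective {a} {b} same = begin
    a                            ≡⟨ unpairFst-pair a (pad a) ⟨
    unpairFst (pair a (pad a))   ≡⟨ cong unpairFst (S-injective same) ⟩
    unpairFst (pair b (pad b))   ≡⟨ unpairFst-pair b (pad b) ⟩
    b                            ∎
    where open ≡-Reasoning

  ψ<f : ∀ z → ψ z < f z
  ψ<f z = m∸n≡0⇒m≤n (proj₁ (proj₂ (pad-exists z)))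

  -- Φ_{f z}^O (f z) is the bounded simulation of Φ_{E z}(J z), as f z > 0.
  f-simulates : ∀ {O} z {y} → Φ (f z) O (f z) y ⇔ O ⊢ simulateC [ pair z (pad z) ∷ [] ]⇓ y
  f-simulates z = mk⇔ (λ Φ↓ → selectC-elim (pair z (pad z)) (f z) 0<f (S-sound _ _ Φ↓))
                      (λ sim → S-complete _ _ (selectC-intro (pair z (pad z)) (f z) 0<f sim))
    where
    0<f : 0 < f z
    0<f = ≤-trans (s≤s z≤n) (ψ<f z)

  -- ⟨e, i, j⟩ ∈ A^{b₀} gives f ⟨e, i, j⟩ ∈ A^b, witnessed by the index ψ z ≤ f z.
  forward : ∀ A z → boundedJump₀ φ Φ t A z → boundedJump φ Φ A (f z)
  forward A z (e , i , j , refl , m , φ↓ , y , Φ↓) =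
    ψ z , <⇒≤ (ψ<f z) , m , ψ-index z (f z) φ↓' , y ,
    Equivalence.from (f-simulates z) (simulateC-intro z (pad z) φ↓' Φ↓')
    where
    φ↓' : φ (I z) (J z) m
    φ↓' = decode (λ _ i j → φ i j m) φ↓

    Φ↓' : restrict (A ↾ m) (suc m) ⊢ uΦ [ E z ∷ J z ∷ [] ]⇓ y
    Φ↓' = decode (λ e _ j → restrict (A ↾ m) (suc m) ⊢ uΦ [ e ∷ j ∷ [] ]⇓ y)
                 (⇓-mono (↾⊑restrict A m) (proj₁ (proj₂ AΦ.universal (A ↾ m) e j y) Φ↓))

  -- Conversely f z ∈ A^b gives z ∈ A^{b₀}; the bounding index i ≤ f z is not needed,
  -- since the simulation only queries the oracle below φ_{I z}(J z) + 1.
  backward : ∀ A z → boundedJump φ Φ A (f z) → boundedJump₀ φ Φ t A z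
  backward A z (_ , _ , m' , _ , y , Φ↓)
    with simulateC-elim z (pad z) (Equivalence.to (f-simulates z) Φ↓)
  ... | m , φ↓ , u↓ =
    E z , I z , J z , sym (right-inverse z) , m , φ↓ , y ,
    proj₂ (proj₂ AΦ.universal (A ↾ m) (E z) (J z) y) (⇓-mono (restrict⊑↾ A m m') u↓)

mainTheorem7 : (φ : Enumeration) → Acceptable φ →
               (Φ : FunctionalEnumeration) → AcceptableF Φ →
               (t : ℕ → ℕ → ℕ → ℕ) → TripleCoding t →
               (A : SetN) → boundedJump₀ φ Φ t A ≤₁ boundedJump φ Φ A
mainTheorem7 φ φ-acceptable Φ Φ-acceptable t t-coding A =
  f , f-computable , f-injective , λ z → forward A z , backward A z
  where open Reduction φ φ-acceptable Φ Φ-acceptable t t-coding
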